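{- Let $M$ be a finite aperiodic monoid such that $\mathbb X_{\mathcal R}(M)$ is linear. Then for all distinct $a,b\in M$ with $a\,\mathcal R\, b$ there are two distinct $g,h\in M$ such that $ag=b$, $bh=a$, $gh=h$ and $hg=g$. In particular $gM=hM$.
   Context: $M$ is aperiodic if for every $a$ there is $n$ with $a^n=a^{n+1}$. $a\,\mathcal R\, b$ iff $aM=bM$. $\mathbb X_{\mathcal R}(M)=\{aM:[a]_{\mathcal R}\text{ has more than one element}\}$, linear if linearly ordered by inclusion. -}

module Defs where

open import Level using (Level; _⊔_)
open import Algebra.Bundles using (Monoid)
open import Data.Nat using (ℕ; zero; suc)
open import Data.Fin using (Fin)
open import Data.Product using (Σ; ∃; _×_; _,_)
open import Data.Sum using (_⊎_)
open import Relation.Nullary using (¬_)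

module _ {c ℓ : Level} (M : Monoid c ℓ) where
  open Monoid M

  pow : Carrier → ℕ → Carrier
  pow a zero    = ε
  pow a (suc n) = a ∙ pow a n

  IsFinite : Set (c ⊔ ℓ)
  IsFinite = Σ ℕ λ n → Σ (Fin n → Carrier) λ f → ∀ (x : Carrier) → ∃ λ i → f i ≈ x

  Aperiodic : Set (c ⊔ ℓ)
  Aperiodic = ∀ (a : Carrier) → ∃ λ (n : ℕ) → pow a n ≈ pow a (suc n)

  _∈R_ : Carrier → Carrier → Set (c ⊔ ℓ)
  z ∈R a = ∃ λ x → a ∙ x ≈ z

  _⊆R_ : Carrier → Carrier → Set (c ⊔ ℓ)
  a ⊆R b = ∀ z → z ∈R a → z ∈R b

  _𝓡_ : Carrier → Carrier → Set (c ⊔ ℓ)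
  a 𝓡 b = (a ⊆R b) × (b ⊆R a)

  NontrivialR : Carrier → Set (c ⊔ ℓ)
  NontrivialR a = ∃ λ b → (b 𝓡 a) × ¬ (b ≈ a)

  -- X_R(M) = { aM : [a]_R nontrivial } is linearly ordered by inclusion
  LinearXR : Set (c ⊔ ℓ)
  LinearXR = ∀ a b → NontrivialR a → NontrivialR b → (a ⊆R b) ⊎ (b ⊆R a)

-- Let a x = b and b y = a.  A power e of x y is idempotent, fixes a, and is absorbed by x y;
-- then f = y e x is an idempotent fixing b.  Both generate nontrivial R-classes (e R e x, and
-- e x ≠ e since otherwise b = a), so by linearity eM ⊆ fM or fM ⊆ eM, the two cases being
-- exchanged by swapping (a, x, e) with (b, y, f).  If eM ⊆ fM then e = f e = y e (x e), and
-- aperiodicity of x e forces e x e = e; the pair g = e x, h = e then does the job.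
module Submission where

open import Defs
open import Level using (Level; _⊔_)
open import Algebra.Bundles using (Monoid)
open import Data.Nat using (ℕ; zero; suc)
open import Data.Product using (∃; _×_; _,_)
open import Data.Sum using (_⊎_; inj₁; inj₂)
open import Relation.Nullary using (¬_)

module _ {c ℓ : Level} (M : Monoid c ℓ) where
  open Monoid M
  open import Relation.Binary.Reasoning.Setoid setoid

  pow-suc-comm : ∀ u n → pow M u n ∙ u ≈ u ∙ pow M u n
  pow-suc-comm u zero    = trans (identityˡ u) (sym (identityʳ u))
  pow-suc-comm u (suc n) = trans (assoc u (pow M u n) u) (∙-congˡ (pow-suc-comm u n))

  ∙-pow-fixed : ∀ {z u} → z ∙ u ≈ z → ∀ n → z ∙ pow M u n ≈ z
  ∙-pow-fixed {z} z∙u≈z zero    = identityʳ z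
  ∙-pow-fixed {z} {u} z∙u≈z (suc n) = begin
    z ∙ (u ∙ pow M u n)  ≈⟨ assoc z u _ ⟨
    (z ∙ u) ∙ pow M u n  ≈⟨ ∙-congʳ z∙u≈z ⟩
    z ∙ pow M u n        ≈⟨ ∙-pow-fixed z∙u≈z n ⟩
    z                    ∎

  record StablePower (u : Carrier) : Set (c ⊔ ℓ) where
    field
      exponent : ℕ
      stable   : pow M u exponent ≈ pow M u (suc exponent)

    e : Carrier
    e = pow M u exponent

    absorbsʳ : e ∙ u ≈ e
    absorbsʳ = trans (pow-suc-comm u exponent) (sym stable)

    absorbsˡ : u ∙ e ≈ e
    absorbsˡ = sym stable

    idempotent : e ∙ e ≈ e
    idempotent = ∙-pow-fixed absorbsʳ exponent

    fixes : ∀ {z} → z ∙ u ≈ z → z ∙ e ≈ z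
    fixes z∙u≈z = ∙-pow-fixed z∙u≈z exponent

  stablePower : Aperiodic M → ∀ u → StablePower u
  stablePower aperiodic u with aperiodic u
  ... | n , stable = record { exponent = n ; stable = stable }

  -- The pumping argument: d = pᵏ d qᵏ for all k, and qᵏ q = qᵏ for k large.
  fixed-by-sandwich : Aperiodic M → ∀ {d p q} → d ≈ p ∙ (d ∙ q) → d ∙ q ≈ d
  fixed-by-sandwich aperiodic {d} {p} {q} d≈pdq with aperiodic q
  ... | k , stable = begin
      d ∙ q                    ≈⟨ ∙-congʳ (pumped k) ⟩
      (pᵏ ∙ (d ∙ qᵏ)) ∙ q      ≈⟨ assoc pᵏ _ q ⟩
      pᵏ ∙ ((d ∙ qᵏ) ∙ q)      ≈⟨ ∙-congˡ (assoc d qᵏ q) ⟩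
      pᵏ ∙ (d ∙ (qᵏ ∙ q))      ≈⟨ ∙-congˡ (∙-congˡ (trans (pow-suc-comm q k) (sym stable))) ⟩
      pᵏ ∙ (d ∙ qᵏ)            ≈⟨ pumped k ⟨
      d                        ∎
    where
    pᵏ = pow M p k
    qᵏ = pow M q k

    pumped : ∀ n → d ≈ pow M p n ∙ (d ∙ pow M q n)
    pumped zero    = sym (trans (identityˡ _) (identityʳ d))
    pumped (suc n) = begin
      d                                          ≈⟨ pumped n ⟩
      pow M p n ∙ (d ∙ pow M q n)                ≈⟨ ∙-congˡ (∙-congʳ d≈pdq) ⟩
      pow M p n ∙ ((p ∙ (d ∙ q)) ∙ pow M q n)    ≈⟨ ∙-congˡ (assoc p _ _) ⟩
      pow M p n ∙ (p ∙ ((d ∙ q) ∙ pow M q n))    ≈⟨ ∙-congˡ (∙-congˡ (assoc d q _)) ⟩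
      pow M p n ∙ (p ∙ (d ∙ (q ∙ pow M q n)))    ≈⟨ assoc (pow M p n) p _ ⟨
      (pow M p n ∙ p) ∙ (d ∙ (q ∙ pow M q n))    ≈⟨ ∙-congʳ (pow-suc-comm p n) ⟩
      (p ∙ pow M p n) ∙ (d ∙ (q ∙ pow M q n))    ∎

  principal-𝓡 : ∀ {d s t} → (d ∙ s) ∙ t ≈ d → _𝓡_ M (d ∙ s) d
  principal-𝓡 {d} {s} {t} ds∙t≈d =
      (λ z (w , dsw≈z) → s ∙ w , trans (sym (assoc d s w)) dsw≈z)
    , (λ z (w , dw≈z) → t ∙ w , trans (sym (assoc (d ∙ s) t w)) (trans (∙-congʳ ds∙t≈d) dw≈z))

  nontrivial-if-moves : ∀ {z d s t} → z ∙ d ≈ z → ¬ (z ∙ s ≈ z) → (d ∙ s) ∙ t ≈ d →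
                        NontrivialR M d
  nontrivial-if-moves {z} {d} {s} z∙d≈z zs≉z ds∙t≈d = d ∙ s , principal-𝓡 ds∙t≈d , ds≉d
    where
    ds≉d : ¬ (d ∙ s ≈ d)
    ds≉d ds≈d = zs≉z (begin
      z ∙ s        ≈⟨ ∙-congʳ z∙d≈z ⟨
      (z ∙ d) ∙ s  ≈⟨ assoc z d s ⟩
      z ∙ (d ∙ s)  ≈⟨ ∙-congˡ ds≈d ⟩
      z ∙ d        ≈⟨ z∙d≈z ⟩
      z            ∎)

  idempotent-⊆R : ∀ {e f} → f ∙ f ≈ f → _⊆R_ M e f → f ∙ e ≈ e
  idempotent-⊆R {e} {f} ff≈f e⊆f with e⊆f e (ε , identityʳ e)
  ... | w , fw≈e = begin
    f ∙ e        ≈⟨ ∙-congˡ fw≈e ⟨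
    f ∙ (f ∙ w)  ≈⟨ assoc f f w ⟨
    (f ∙ f) ∙ w  ≈⟨ ∙-congʳ ff≈f ⟩
    f ∙ w        ≈⟨ fw≈e ⟩
    e            ∎

  module _ {x y e : Carrier} (e∙xy≈e : e ∙ (x ∙ y) ≈ e) where

    absorbs-xy : ∀ w → e ∙ (x ∙ (y ∙ w)) ≈ e ∙ w
    absorbs-xy w = begin
      e ∙ (x ∙ (y ∙ w))  ≈⟨ ∙-congˡ (assoc x y w) ⟨
      e ∙ ((x ∙ y) ∙ w)  ≈⟨ assoc e _ w ⟨
      (e ∙ (x ∙ y)) ∙ w  ≈⟨ ∙-congʳ e∙xy≈e ⟩
      e ∙ w              ∎

    conjugate-idempotent : e ∙ e ≈ e → (y ∙ (e ∙ x)) ∙ (y ∙ (e ∙ x)) ≈ y ∙ (e ∙ x)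
    conjugate-idempotent ee≈e = begin
      (y ∙ (e ∙ x)) ∙ (y ∙ (e ∙ x))  ≈⟨ assoc y _ _ ⟩
      y ∙ ((e ∙ x) ∙ (y ∙ (e ∙ x)))  ≈⟨ ∙-congˡ (assoc e x _) ⟩
      y ∙ (e ∙ (x ∙ (y ∙ (e ∙ x))))  ≈⟨ ∙-congˡ (absorbs-xy (e ∙ x)) ⟩
      y ∙ (e ∙ (e ∙ x))              ≈⟨ ∙-congˡ (assoc e e x) ⟨
      y ∙ ((e ∙ e) ∙ x)              ≈⟨ ∙-congˡ (∙-congʳ ee≈e) ⟩
      y ∙ (e ∙ x)                    ∎

    conjugate-absorbs-yx : ((y ∙ (e ∙ x)) ∙ y) ∙ x ≈ y ∙ (e ∙ x)
    conjugate-absorbs-yx = begin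
      ((y ∙ (e ∙ x)) ∙ y) ∙ x  ≈⟨ assoc _ y x ⟩
      (y ∙ (e ∙ x)) ∙ (y ∙ x)  ≈⟨ assoc y _ _ ⟩
      y ∙ ((e ∙ x) ∙ (y ∙ x))  ≈⟨ ∙-congˡ (assoc e x _) ⟩
      y ∙ (e ∙ (x ∙ (y ∙ x)))  ≈⟨ ∙-congˡ (absorbs-xy x) ⟩
      y ∙ (e ∙ x)              ∎

    conjugate-back : (x ∙ y) ∙ e ≈ e → x ∙ ((y ∙ (e ∙ x)) ∙ y) ≈ e
    conjugate-back xy∙e≈e = begin
      x ∙ ((y ∙ (e ∙ x)) ∙ y)  ≈⟨ ∙-congˡ (assoc y _ y) ⟩
      x ∙ (y ∙ ((e ∙ x) ∙ y))  ≈⟨ assoc x y _ ⟨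
      (x ∙ y) ∙ ((e ∙ x) ∙ y)  ≈⟨ ∙-congˡ (assoc e x y) ⟩
      (x ∙ y) ∙ (e ∙ (x ∙ y))  ≈⟨ ∙-congˡ e∙xy≈e ⟩
      (x ∙ y) ∙ e              ≈⟨ xy∙e≈e ⟩
      e                        ∎

  Exchange : Carrier → Carrier → Carrier → Carrier → Set ℓ
  Exchange a b g h = (a ∙ g ≈ b) × (b ∙ h ≈ a) × (g ∙ h ≈ h) × (h ∙ g ≈ g)

  swap-Exchange : ∀ {a b g h} → Exchange a b g h → Exchange b a h g
  swap-Exchange (ag≈b , bh≈a , gh≈h , hg≈g) = bh≈a , ag≈b , hg≈g , gh≈h

  Exchange-distinct : ∀ {a b g h} → ¬ (a ≈ b) → Exchange a b g h → ¬ (g ≈ h)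
  Exchange-distinct {a} {b} {g} {h} a≉b (ag≈b , bh≈a , gh≈h , _) g≈h = a≉b (begin
    a            ≈⟨ bh≈a ⟨
    b ∙ h        ≈⟨ ∙-congˡ gh≈h ⟨
    b ∙ (g ∙ h)  ≈⟨ assoc b g h ⟨
    (b ∙ g) ∙ h  ≈⟨ ∙-congʳ (∙-congˡ g≈h) ⟩
    (b ∙ h) ∙ h  ≈⟨ ∙-congʳ bh≈a ⟩
    a ∙ h        ≈⟨ ∙-congˡ g≈h ⟨
    a ∙ g        ≈⟨ ag≈b ⟩
    b            ∎)

  Exchange-𝓡 : ∀ {a b g h} → Exchange a b g h → _𝓡_ M g h
  Exchange-𝓡 {g = g} {h} (_ , _ , gh≈h , hg≈g) =
      (λ z (w , gw≈z) → g ∙ w , trans (sym (assoc h g w)) (trans (∙-congʳ hg≈g) gw≈z))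
    , (λ z (w , hw≈z) → h ∙ w , trans (sym (assoc g h w)) (trans (∙-congʳ gh≈h) hw≈z))

  exchange-below : Aperiodic M → ∀ {a b x y e} →
    a ∙ x ≈ b → a ∙ e ≈ a → e ∙ e ≈ e → (y ∙ (e ∙ x)) ∙ e ≈ e → Exchange a b (e ∙ x) e
  exchange-below aperiodic {a} {b} {x} {y} {e} ax≈b ae≈a ee≈e yex∙e≈e =
    ae∙x≈b , be≈a , trans (assoc e x e) exe≈e , trans (sym (assoc e e x)) (∙-congʳ ee≈e)
    where
    exe≈e : e ∙ (x ∙ e) ≈ e
    exe≈e = fixed-by-sandwich aperiodic (begin
      e                  ≈⟨ yex∙e≈e ⟨
      (y ∙ (e ∙ x)) ∙ e  ≈⟨ assoc y _ e ⟩
      y ∙ ((e ∙ x) ∙ e)  ≈⟨ ∙-congˡ (assoc e x e) ⟩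
      y ∙ (e ∙ (x ∙ e))  ∎)

    ae∙x≈b : a ∙ (e ∙ x) ≈ b
    ae∙x≈b = trans (sym (assoc a e x)) (trans (∙-congʳ ae≈a) ax≈b)

    be≈a : b ∙ e ≈ a
    be≈a = begin
      b ∙ e              ≈⟨ ∙-congʳ ae∙x≈b ⟨
      (a ∙ (e ∙ x)) ∙ e  ≈⟨ assoc a _ e ⟩
      a ∙ ((e ∙ x) ∙ e)  ≈⟨ ∙-congˡ (trans (assoc e x e) exe≈e) ⟩
      a ∙ e              ≈⟨ ae≈a ⟩
      a                  ∎

  exchange : Aperiodic M → LinearXR M →
    ∀ {a b} → ¬ (a ≈ b) → _𝓡_ M a b → ∃ λ g → ∃ λ h → Exchange a b g h
  exchange aperiodic linear {a} {b} a≉b (a⊆b , b⊆a)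
    with b⊆a b (ε , identityʳ b) | a⊆b a (ε , identityʳ a)
  ... | x , ax≈b | y , by≈a =
    by-cases (linear e f (nontrivial-if-moves ae≈a ax≉a ex∙y≈e) (nontrivial-if-moves bf≈b by≉b fy∙x≈f))
    where
    open StablePower (stablePower aperiodic (x ∙ y))

    f : Carrier
    f = y ∙ (e ∙ x)

    ae≈a : a ∙ e ≈ a
    ae≈a = fixes (trans (sym (assoc a x y)) (trans (∙-congʳ ax≈b) by≈a))

    bf≈b : b ∙ f ≈ b
    bf≈b = begin
      b ∙ (y ∙ (e ∙ x))  ≈⟨ assoc b y _ ⟨
      (b ∙ y) ∙ (e ∙ x)  ≈⟨ ∙-congʳ by≈a ⟩
      a ∙ (e ∙ x)        ≈⟨ assoc a e x ⟨
      (a ∙ e) ∙ x        ≈⟨ ∙-congʳ ae≈a ⟩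
      a ∙ x              ≈⟨ ax≈b ⟩
      b                  ∎

    ax≉a : ¬ (a ∙ x ≈ a)
    ax≉a ax≈a = a≉b (trans (sym ax≈a) ax≈b)

    by≉b : ¬ (b ∙ y ≈ b)
    by≉b by≈b = a≉b (trans (sym by≈a) by≈b)

    ex∙y≈e : (e ∙ x) ∙ y ≈ e
    ex∙y≈e = trans (assoc e x y) absorbsʳ

    fy∙x≈f : (f ∙ y) ∙ x ≈ f
    fy∙x≈f = conjugate-absorbs-yx absorbsʳ

    ff≈f : f ∙ f ≈ f
    ff≈f = conjugate-idempotent absorbsʳ idempotent

    by-cases : (_⊆R_ M e f) ⊎ (_⊆R_ M f e) → ∃ λ g → ∃ λ h → Exchange a b g h
    by-cases (inj₁ e⊆f) =
      e ∙ x , e , exchange-below aperiodic ax≈b ae≈a idempotent (idempotent-⊆R ff≈f e⊆f)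
    by-cases (inj₂ f⊆e) =
      f , f ∙ y , swap-Exchange (exchange-below aperiodic by≈a bf≈b ff≈f
        (trans (∙-congʳ (conjugate-back absorbsʳ absorbsˡ)) (idempotent-⊆R idempotent f⊆e)))

lemma3p3 : {c ℓ : Level} (M : Monoid c ℓ) →
    IsFinite M → Aperiodic M → LinearXR M →
    ∀ (a b : Monoid.Carrier M) → ¬ (Monoid._≈_ M a b) → _𝓡_ M a b →
    ∃ λ (g : Monoid.Carrier M) → ∃ λ (h : Monoid.Carrier M) →
    ¬ (Monoid._≈_ M g h)
    × Monoid._≈_ M (Monoid._∙_ M a g) b
    × Monoid._≈_ M (Monoid._∙_ M b h) a
    × Monoid._≈_ M (Monoid._∙_ M g h) h
    × Monoid._≈_ M (Monoid._∙_ M h g) g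
    × _𝓡_ M g h
lemma3p3 M _ aperiodic linear a b a≉b a𝓡b with exchange M aperiodic linear a≉b a𝓡b
... | g , h , ex@(ag≈b , bh≈a , gh≈h , hg≈g) =
  g , h , Exchange-distinct M a≉b ex , ag≈b , bh≈a , gh≈h , hg≈g , Exchange-𝓡 M ex
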